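{- Let $\mathcal{P} = \{P^1,\ldots,P^u\}$ be a collection of partitions of $[n]$ into $w$-sized blocks that is $(q,\tau)$-load balancing. Then $$I_q(f_\mathcal{P}) \leq \big(u(1-2^{ -w})^{v-q}\big)\cdot(\tau 2^{ -w})\cdot q.$$
   Context: A partition $P$ of $[n]$ into $w$-sized blocks is $P=\{P_1,\ldots,P_v\}$ with $v=n/w$, each $|P_j|=w$. $T_P(x)=\bigvee_{j=1}^v\bigwedge_{\ell\in P_j}x_\ell$ and $f_\mathcal{P}(x)=\bigwedge_{i=1}^u T_{P^i}(x)$. $\mathcal{P}$ is $(q,\tau)$-load balancing if for all $Q\subseteq[n]$ with $|Q|\le q$ and all $j\in[v]$, $\mathbb{E}_{\alpha\in_u[u]}\big[\mathbf{1}(Q\cap P^\alpha_j\neq\emptyset)\,2^{|Q\cap P^\alpha_j|}\big] \le \tau\cdot(q/v)$. For $f:\{0,1\}^n\to\{0,1\}$ and $Q\subseteq[n]$, $I_Q(f)$ is the probability that $f$ is not determined (not constant in the bits of $Q$) after the bits outside $Q$ are set uniformly at random, and $I_q(f)=\max_{|Q|\le q}I_Q(f)$.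
   Formalization: The load-balancing parameter τ takes rational values. -}

module Defs where

open import Data.Bool using (Bool; true; false; not; _∧_; _∨_; _xor_)
open import Data.Nat as ℕ using (ℕ; zero; suc; _∸_; _≡ᵇ_)
import Data.Nat.Properties as ℕP
open import Data.Fin using (Fin)
open import Data.Fin.Properties using () renaming (_≟_ to _≟ᶠ_)
open import Data.List using (List; []; _∷_; length; filterᵇ; map; concatMap; allFin; foldr)
open import Data.Bool.ListAction using (any; all)
open import Data.Nat.ListAction using (sum)
import Data.Vec.Functional as VF
open import Data.Integer using (ℤ; +_; -[1+_])
open import Data.Rational using (ℚ; 0ℚ; 1ℚ; ½; _*_; _⊔_; _/_; 1/_; ≢-nonZero)
open import Data.Rational.Properties using () renaming (_≟_ to _≟ℚ_)
open import Data.Product using (Σ)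
open import Relation.Nullary using (yes; no; ⌊_⌋)
open import Relation.Binary.PropositionalEquality using (_≡_)

countᵇ : {A : Set} → (A → Bool) → List A → ℕ
countᵇ p xs = length (filterᵇ p xs)

ℕ→ℚ : ℕ → ℚ
ℕ→ℚ k = (+ k) / 1

_^ℚ_ : ℚ → ℕ → ℚ
b ^ℚ zero  = 1ℚ
b ^ℚ suc k = b * (b ^ℚ k)

-- total inverse (0⁻¹ := 0; only used on nonzero arguments below)
inv : ℚ → ℚ
inv b with b ≟ℚ 0ℚ
... | yes _  = 0ℚ
... | no b≢0 = 1/_ b {{≢-nonZero b≢0}}

_^ℤ_ : ℚ → ℤ → ℚ
b ^ℤ (+ k)     = b ^ℚ k
b ^ℤ -[1+ k ]  = (inv b) ^ℚ (suc k)

2^-_ : ℕ → ℚ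
2^- k = ½ ^ℚ k

-- Subsets of [n] and assignments: both are maps Fin n → Bool

Assign : ℕ → Set
Assign n = Fin n → Bool

allAssign : (n : ℕ) → List (Assign n)
allAssign zero    = (λ ()) ∷ []
allAssign (suc n) = concatMap (λ x → (false VF.∷ x) ∷ (true VF.∷ x) ∷ []) (allAssign n)

∣_∣ : {n : ℕ} → Assign n → ℕ
∣_∣ {n} Q = countᵇ Q (allFin n)

-- Partitions of [n] into v blocks P_1..P_v each of size w:
-- blk ℓ = the index j of the block P_j containing ℓ.

blockSize : {n v : ℕ} → (Fin n → Fin v) → Fin v → ℕ
blockSize {n} blk j = countᵇ (λ ℓ → ⌊ blk ℓ ≟ᶠ j ⌋) (allFin n)

Partition : (n v w : ℕ) → Set
Partition n v w = Σ (Fin n → Fin v) (λ blk → ∀ j → blockSize blk j ≡ w)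

T-P : {n v w : ℕ} → Partition n v w → Assign n → Bool
T-P {n} {v} (blk Data.Product., _) x =
  any (λ j → all (λ ℓ → not ⌊ blk ℓ ≟ᶠ j ⌋ ∨ x ℓ) (allFin n)) (allFin v)

f-𝒫 : {n v w u : ℕ} → (Fin u → Partition n v w) → Assign n → Bool
f-𝒫 {u = u} 𝒫 x = all (λ i → T-P (𝒫 i) x) (allFin u)

_==ᵇ_ : Bool → Bool → Bool
a ==ᵇ b = not (a xor b)

agreeOutside : {n : ℕ} → Assign n → Assign n → Assign n → Bool
agreeOutside {n} Q x y = all (λ ℓ → Q ℓ ∨ (x ℓ ==ᵇ y ℓ)) (allFin n)

undetermined : {n : ℕ} → (Assign n → Bool) → Assign n → Assign n → Bool
undetermined {n} f Q x =
  any (λ y → any (λ z → agreeOutside Q x y ∧ agreeOutside Q x z ∧ not (f y ==ᵇ f z))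
                 (allAssign n))
      (allAssign n)

-- I_Q(f): probability over a uniformly random setting of the bits outside Q
-- (equivalently: of all n bits, the event depending only on bits outside Q)
I-Q : {n : ℕ} → (Assign n → Bool) → Assign n → ℚ
I-Q {n} f Q = ℕ→ℚ (countᵇ (undetermined f Q) (allAssign n)) * 2^- n

-- I_q(f) = max_{|Q| ≤ q} I_Q(f)   (Q = ∅ is always admissible; I_Q ≥ 0)
I-q : {n : ℕ} → (Assign n → Bool) → ℕ → ℚ
I-q {n} f q =
  foldr _⊔_ 0ℚ (map (I-Q f) (filterᵇ (λ Q → ∣ Q ∣ ℕ.≤ᵇ q) (allAssign n)))

interSize : {n v w : ℕ} → Assign n → Partition n v w → Fin v → ℕ
interSize {n} Q (blk Data.Product., _) j = countᵇ (λ ℓ → Q ℓ ∧ ⌊ blk ℓ ≟ᶠ j ⌋) (allFin n)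

-- 1(Q ∩ P_j ≠ ∅) · 2^{|Q ∩ P_j|}
lbTerm : ℕ → ℕ
lbTerm zero    = 0
lbTerm (suc k) = 2 ℕ.^ suc k

LoadBalancing : {n v w u : ℕ} → .{{_ : ℕ.NonZero u}} → .{{_ : ℕ.NonZero v}} →
  (Fin u → Partition n v w) → ℕ → ℚ → Set
LoadBalancing {n} {v} {w} {u} 𝒫 q τ =
  ∀ (Q : Assign n) → ∣ Q ∣ ℕ.≤ q → ∀ (j : Fin v) →
    (+ sum (map (λ α → lbTerm (interSize Q (𝒫 α) j)) (allFin u))) / u
      Data.Rational.≤ τ * ((+ q) / v)

module Submission where

-- If f_𝒫 is not determined on Q after fixing the bits x outside Q, two completions y, z of x
-- disagree, so some T_{P^i} is switched by the bits in Q.  Then P^i has a critical block j: it meets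
-- Q, x is all-ones on P^i_j ∖ Q, and x has a zero in every block of P^i disjoint from Q.  Distinct
-- blocks are disjoint sets of independent bits, so with t = |Q ∩ P^i_j| and L ≥ v - q blocks
-- disjoint from Q this event has probability 2^{-(w-t)} (1 - 2^{-w})^L ≤ 2^{-w} (1 - 2^{-w})^{v-q} 2^t.
-- A union bound over (i, j) leaves Σ_j Σ_i 1(t_ij > 0) 2^{t_ij}, and load balancing bounds each
-- inner sum by u τ q / v.

open import Algebra.Bundles using (CommutativeSemiring; CommutativeRing)
open import Data.Fin as Fin using (Fin; zero; suc)
open import Data.List using (List; []; _∷_; _++_; concatMap; tabulate; allFin; map; length; filterᵇ; foldr)
open import Data.Nat as ℕ using (ℕ; zero; suc; NonZero; _≡ᵇ_)
open import Function using (_∘_; id)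

module ListSum {c ℓ} (R : CommutativeSemiring c ℓ) where

  open CommutativeSemiring R
  open import Algebra.Properties.CommutativeSemigroup +-commutativeSemigroup using (interchange)

  ∑ : {A : Set} → List A → (A → Carrier) → Carrier
  ∑ []       f = 0#
  ∑ (x ∷ xs) f = f x + ∑ xs f

  ∑-cong : {A : Set} (xs : List A) {f g : A → Carrier} → (∀ x → f x ≈ g x) → ∑ xs f ≈ ∑ xs g
  ∑-cong []       f≈g = refl
  ∑-cong (x ∷ xs) f≈g = +-cong (f≈g x) (∑-cong xs f≈g)

  ∑-zero : {A : Set} (xs : List A) → ∑ xs (λ _ → 0#) ≈ 0#
  ∑-zero []       = refl
  ∑-zero (x ∷ xs) = trans (+-identityˡ _) (∑-zero xs)

  ∑-distrib-+ : {A : Set} (xs : List A) (f g : A → Carrier) →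
    ∑ xs (λ x → f x + g x) ≈ ∑ xs f + ∑ xs g
  ∑-distrib-+ []       f g = sym (+-identityˡ 0#)
  ∑-distrib-+ (x ∷ xs) f g =
    trans (+-congˡ (∑-distrib-+ xs f g)) (interchange (f x) (g x) (∑ xs f) (∑ xs g))

  ∑-distribˡ-* : {A : Set} (xs : List A) (a : Carrier) (f : A → Carrier) →
    ∑ xs (λ x → a * f x) ≈ a * ∑ xs f
  ∑-distribˡ-* []       a f = sym (zeroʳ a)
  ∑-distribˡ-* (x ∷ xs) a f =
    trans (+-congˡ (∑-distribˡ-* xs a f)) (sym (distribˡ a (f x) (∑ xs f)))

  ∑-comm : {A B : Set} (xs : List A) (ys : List B) (f : A → B → Carrier) →
    ∑ xs (λ x → ∑ ys (f x)) ≈ ∑ ys (λ y → ∑ xs (λ x → f x y))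
  ∑-comm []       ys f = sym (∑-zero ys)
  ∑-comm (x ∷ xs) ys f =
    trans (+-congˡ (∑-comm xs ys f)) (sym (∑-distrib-+ ys (f x) (λ y → ∑ xs (λ x → f x y))))

  ∑-++ : {A : Set} (xs ys : List A) (f : A → Carrier) → ∑ (xs ++ ys) f ≈ ∑ xs f + ∑ ys f
  ∑-++ []       ys f = sym (+-identityˡ _)
  ∑-++ (x ∷ xs) ys f = trans (+-congˡ (∑-++ xs ys f)) (sym (+-assoc (f x) (∑ xs f) (∑ ys f)))

  ∑-concatMap : {A B : Set} (h : A → List B) (xs : List A) (f : B → Carrier) →
    ∑ (concatMap h xs) f ≈ ∑ xs (λ x → ∑ (h x) f)
  ∑-concatMap h []       f = refl
  ∑-concatMap h (x ∷ xs) f = trans (∑-++ (h x) (concatMap h xs) f) (+-congˡ (∑-concatMap h xs f))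

  ∑-tabulate : {A : Set} {n : ℕ} (g : Fin n → A) (f : A → Carrier) →
    ∑ (tabulate g) f ≈ ∑ (allFin n) (f ∘ g)
  ∑-tabulate {n = zero}  g f = refl
  ∑-tabulate {n = suc n} g f =
    +-congˡ (trans (∑-tabulate (g ∘ suc) f) (sym (∑-tabulate suc (f ∘ g))))

open import Data.Bool using (Bool; true; false; T; not; _∧_; _∨_)
open import Data.Bool.ListAction using (and; any; all)
open import Data.Bool.Properties using (T-∨; T-≡; T-∧)
open import Data.Empty using (⊥-elim)
open import Data.Fin.Properties using () renaming (_≟_ to _≟ᶠ_)
import Data.Integer as ℤ
import Data.Integer.Properties as ℤP
open import Data.Integer.Solver using () renaming (module +-*-Solver to ℤSolver)
open import Data.List.Membership.Propositional using (_∈_)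
open import Data.List.Membership.Propositional.Properties using (∈-allFin; ∈-filter⁻)
open import Data.List.Properties using (map-tabulate; length-tabulate; map-cong)
open import Data.List.Relation.Unary.All as All using (All; []; _∷_)
import Data.List.Relation.Unary.All.Properties as AllP
open import Data.List.Relation.Unary.All.Properties using (all⁺; all⁻; ¬All⇒Any¬)
open import Data.List.Relation.Unary.AllPairs using ([]; _∷_)
import Data.List.Relation.Unary.Any as AnyP
open import Data.List.Relation.Unary.Any using (here; there; satisfied)
open import Data.List.Relation.Unary.Any.Properties using (any⁺; any⁻)
open import Data.List.Relation.Unary.Unique.Propositional using (Unique)
open import Data.List.Relation.Unary.Unique.Propositional.Properties using (allFin⁺; filter⁺)
open import Data.Nat.ListAction using (sum)
import Data.Nat.Properties as ℕP
open import Data.Product using (∃; _,_; _×_; proj₁; proj₂)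
open import Data.Rational as ℚ using (ℚ; 0ℚ; 1ℚ; ½; _+_; _*_; _-_; _/_; 1/_; _⊔_; _≤_; _<_)
import Data.Rational.Properties as ℚP
open import Data.Rational.Solver using (module +-*-Solver)
open import Data.Rational.Unnormalised as ℚᵘ using (mkℚᵘ; *≡*)
import Data.Rational.Unnormalised.Properties as ℚᵘP
open import Data.Sum using (_⊎_; inj₁; inj₂)
open import Data.Unit using (tt)
import Data.Vec.Functional as VF
open import Function.Bundles using (Equivalence)
open import Relation.Binary.PropositionalEquality using (_≡_; _≢_; refl; sym; trans; cong; cong₂; subst; module ≡-Reasoning)
open import Relation.Nullary using (¬_; yes; no)
open import Relation.Nullary.Decidable using (T?; ⌊_⌋; toWitness)

open import Defs

open ListSum (CommutativeRing.commutativeSemiring ℚP.+-*-commutativeRing)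
module ℕ∑ = ListSum ℕP.+-*-commutativeSemiring

*-nonNeg : ∀ {p q} → 0ℚ ≤ p → 0ℚ ≤ q → 0ℚ ≤ p * q
*-nonNeg {p} {q} 0≤p 0≤q = ℚP.nonNegative⁻¹ _ {{ℚP.nonNeg*nonNeg⇒nonNeg p {{ℚ.nonNegative 0≤p}} q {{ℚ.nonNegative 0≤q}}}}

*-mono-≤-nonNeg : ∀ {a b c d} → 0ℚ ≤ a → 0ℚ ≤ c → a ≤ b → c ≤ d → a * c ≤ b * d
*-mono-≤-nonNeg {a} {b} {c} {d} 0≤a 0≤c a≤b c≤d =
  ℚP.≤-trans (ℚP.*-monoʳ-≤-nonNeg c {{ℚ.nonNegative 0≤c}} a≤b)
             (ℚP.*-monoˡ-≤-nonNeg b {{ℚ.nonNegative (ℚP.≤-trans 0≤a a≤b)}} c≤d)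

½*[x+x]≡x : ∀ a → ½ * (a + a) ≡ a
½*[x+x]≡x a = trans (ℚP.*-distribˡ-+ ½ a a) (trans (sym (ℚP.*-distribʳ-+ a ½ ½)) (ℚP.*-identityˡ a))

-- ℕ→ℚ a is definitionally fromℚᵘ (mkℚᵘ (+ a) 0), so its arithmetic can be done in ℚᵘ.
fromℚᵘ-homo-+ : ∀ p q → ℚ.fromℚᵘ (p ℚᵘ.+ q) ≡ ℚ.fromℚᵘ p + ℚ.fromℚᵘ q
fromℚᵘ-homo-+ p q = ℚP.toℚᵘ-injective (begin
  ℚ.toℚᵘ (ℚ.fromℚᵘ (p ℚᵘ.+ q))                        ≈⟨ ℚP.toℚᵘ-fromℚᵘ _ ⟩
  p ℚᵘ.+ q                                            ≈⟨ ℚᵘP.+-cong (ℚᵘP.≃-sym (ℚP.toℚᵘ-fromℚᵘ p)) (ℚᵘP.≃-sym (ℚP.toℚᵘ-fromℚᵘ q)) ⟩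
  ℚ.toℚᵘ (ℚ.fromℚᵘ p) ℚᵘ.+ ℚ.toℚᵘ (ℚ.fromℚᵘ q)         ≈⟨ ℚᵘP.≃-sym (ℚP.toℚᵘ-homo-+ (ℚ.fromℚᵘ p) (ℚ.fromℚᵘ q)) ⟩
  ℚ.toℚᵘ (ℚ.fromℚᵘ p + ℚ.fromℚᵘ q)                     ∎)
  where open ℚᵘP.≃-Reasoning

fromℚᵘ-homo-* : ∀ p q → ℚ.fromℚᵘ (p ℚᵘ.* q) ≡ ℚ.fromℚᵘ p * ℚ.fromℚᵘ q
fromℚᵘ-homo-* p q = ℚP.toℚᵘ-injective (begin
  ℚ.toℚᵘ (ℚ.fromℚᵘ (p ℚᵘ.* q))                        ≈⟨ ℚP.toℚᵘ-fromℚᵘ _ ⟩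
  p ℚᵘ.* q                                            ≈⟨ ℚᵘP.*-cong (ℚᵘP.≃-sym (ℚP.toℚᵘ-fromℚᵘ p)) (ℚᵘP.≃-sym (ℚP.toℚᵘ-fromℚᵘ q)) ⟩
  ℚ.toℚᵘ (ℚ.fromℚᵘ p) ℚᵘ.* ℚ.toℚᵘ (ℚ.fromℚᵘ q)         ≈⟨ ℚᵘP.≃-sym (ℚP.toℚᵘ-homo-* (ℚ.fromℚᵘ p) (ℚ.fromℚᵘ q)) ⟩
  ℚ.toℚᵘ (ℚ.fromℚᵘ p * ℚ.fromℚᵘ q)                     ∎)
  where open ℚᵘP.≃-Reasoning

ℕ→ℚ-homo-+ : ∀ a b → ℕ→ℚ (a ℕ.+ b) ≡ ℕ→ℚ a + ℕ→ℚ b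
ℕ→ℚ-homo-+ a b = trans (ℚP.fromℚᵘ-cong {mkℚᵘ (ℤ.+ (a ℕ.+ b)) 0} {mkℚᵘ (ℤ.+ a) 0 ℚᵘ.+ mkℚᵘ (ℤ.+ b) 0}
  (*≡* (cong (ℤ._* ℤ.+ 1) (trans (ℤP.pos-+ a b) (sym (cong₂ ℤ._+_ (ℤP.*-identityʳ (ℤ.+ a)) (ℤP.*-identityʳ (ℤ.+ b))))))))
  (fromℚᵘ-homo-+ (mkℚᵘ (ℤ.+ a) 0) (mkℚᵘ (ℤ.+ b) 0))

ℕ→ℚ-homo-* : ∀ a b → ℕ→ℚ (a ℕ.* b) ≡ ℕ→ℚ a * ℕ→ℚ b
ℕ→ℚ-homo-* a b = trans (ℚP.fromℚᵘ-cong {mkℚᵘ (ℤ.+ (a ℕ.* b)) 0} {mkℚᵘ (ℤ.+ a) 0 ℚᵘ.* mkℚᵘ (ℤ.+ b) 0}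
  (*≡* (cong (ℤ._* ℤ.+ 1) (ℤP.pos-* a b))))
  (fromℚᵘ-homo-* (mkℚᵘ (ℤ.+ a) 0) (mkℚᵘ (ℤ.+ b) 0))

ℕ→ℚ-*-/ : ∀ m n .{{_ : NonZero n}} → ℕ→ℚ n * ((ℤ.+ m) / n) ≡ ℕ→ℚ m
ℕ→ℚ-*-/ m (suc k) = sym (trans
  (ℚP.fromℚᵘ-cong {mkℚᵘ (ℤ.+ m) 0} {mkℚᵘ (ℤ.+ suc k) 0 ℚᵘ.* mkℚᵘ (ℤ.+ m) k}
    (*≡* (trans (cong (λ d → ℤ.+ m ℤ.* ℤ.+ suc d) (ℕP.+-identityʳ k))
      (trans (ℤP.*-comm (ℤ.+ m) (ℤ.+ suc k)) (sym (ℤP.*-identityʳ _))))))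
  (fromℚᵘ-homo-* (mkℚᵘ (ℤ.+ suc k) 0) (mkℚᵘ (ℤ.+ m) k)))

ℕ→ℚ-nonNeg : ∀ a → 0ℚ ≤ ℕ→ℚ a
ℕ→ℚ-nonNeg a = ℚP.nonNegative⁻¹ _ {{ℚP.normalize-nonNeg a 1}}

2^-‿nonNeg : ∀ k → 0ℚ ≤ 2^- k
2^-‿nonNeg zero    = ℚP.nonNegative⁻¹ 1ℚ
2^-‿nonNeg (suc k) = *-nonNeg (ℚP.nonNegative⁻¹ ½) (2^-‿nonNeg k)

^ℚ-homo-+ : ∀ b a t → b ^ℚ (a ℕ.+ t) ≡ b ^ℚ a * b ^ℚ t
^ℚ-homo-+ b zero    t = sym (ℚP.*-identityˡ _)
^ℚ-homo-+ b (suc a) t = trans (cong (b *_) (^ℚ-homo-+ b a t)) (sym (ℚP.*-assoc b (b ^ℚ a) (b ^ℚ t)))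

^ℚ-nonNeg : ∀ {b} k → 0ℚ ≤ b → 0ℚ ≤ b ^ℚ k
^ℚ-nonNeg zero    0≤b = ℚP.nonNegative⁻¹ 1ℚ
^ℚ-nonNeg (suc k) 0≤b = *-nonNeg 0≤b (^ℚ-nonNeg k 0≤b)

^ℚ-≤1 : ∀ {b} k → 0ℚ ≤ b → b ≤ 1ℚ → b ^ℚ k ≤ 1ℚ
^ℚ-≤1 zero    0≤b b≤1 = ℚP.≤-refl
^ℚ-≤1 (suc k) 0≤b b≤1 = *-mono-≤-nonNeg 0≤b (^ℚ-nonNeg k 0≤b) b≤1 (^ℚ-≤1 k 0≤b b≤1)

1≤^ℚ : ∀ {b} k → 1ℚ ≤ b → 1ℚ ≤ b ^ℚ k
1≤^ℚ zero    1≤b = ℚP.≤-refl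
1≤^ℚ (suc k) 1≤b = *-mono-≤-nonNeg (ℚP.nonNegative⁻¹ 1ℚ) (ℚP.nonNegative⁻¹ 1ℚ) 1≤b (1≤^ℚ k 1≤b)

^ℚ-antimono : ∀ {b} {k m} → 0ℚ ≤ b → b ≤ 1ℚ → k ℕ.≤ m → b ^ℚ m ≤ b ^ℚ k
^ℚ-antimono {b} {k} {m} 0≤b b≤1 k≤m = begin
  b ^ℚ m                   ≡⟨ cong (b ^ℚ_) (sym (ℕP.m+[n∸m]≡n k≤m)) ⟩
  b ^ℚ (k ℕ.+ (m ℕ.∸ k))    ≡⟨ ^ℚ-homo-+ b k (m ℕ.∸ k) ⟩
  b ^ℚ k * b ^ℚ (m ℕ.∸ k)   ≤⟨ ℚP.*-monoˡ-≤-nonNeg (b ^ℚ k) {{ℚ.nonNegative (^ℚ-nonNeg k 0≤b)}} (^ℚ-≤1 (m ℕ.∸ k) 0≤b b≤1) ⟩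
  b ^ℚ k * 1ℚ              ≡⟨ ℚP.*-identityʳ _ ⟩
  b ^ℚ k                   ∎
  where open ℚP.≤-Reasoning

1≤inv : ∀ {b} → 0ℚ < b → b ≤ 1ℚ → 1ℚ ≤ inv b
1≤inv {b} 0<b b≤1 with b ℚP.≟ 0ℚ
... | yes refl = ⊥-elim (ℚP.<-irrefl refl 0<b)
... | no  b≢0  = begin
  1ℚ        ≡⟨ sym (ℚP.*-inverseʳ b {{nz}}) ⟩
  b * b⁻¹   ≤⟨ ℚP.*-monoʳ-≤-nonNeg b⁻¹ {{ℚP.pos⇒nonNeg b⁻¹ {{0<b⁻¹}}}} b≤1 ⟩
  1ℚ * b⁻¹  ≡⟨ ℚP.*-identityˡ b⁻¹ ⟩
  b⁻¹       ∎
  where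
  open ℚP.≤-Reasoning
  nz : ℚ.NonZero b
  nz = ℚ.≢-nonZero b≢0
  b⁻¹ : ℚ
  b⁻¹ = (1/ b) {{nz}}
  0<b⁻¹ : ℚ.Positive b⁻¹
  0<b⁻¹ = ℚP.1/pos⇒pos b {{ℚ.positive 0<b}}

-- Negative exponents i arise when q > v.
^ℚ≤^ℤ : ∀ {b} → 0ℚ < b → b ≤ 1ℚ → ∀ k {i} → i ℤ.≤ ℤ.+ k → b ^ℚ k ≤ b ^ℤ i
^ℚ≤^ℤ 0<b b≤1 k {ℤ.+ m}      (ℤ.+≤+ m≤k) = ^ℚ-antimono (ℚP.<⇒≤ 0<b) b≤1 m≤k
^ℚ≤^ℤ 0<b b≤1 k {ℤ.-[1+ m ]} _          =
  ℚP.≤-trans (^ℚ-≤1 k (ℚP.<⇒≤ 0<b) b≤1) (1≤^ℚ (suc m) (1≤inv 0<b b≤1))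

2^-[a+t]*2^t≡2^-a : ∀ a t → 2^- (a ℕ.+ t) * ℕ→ℚ (2 ℕ.^ t) ≡ 2^- a
2^-[a+t]*2^t≡2^-a a t = begin
  2^- (a ℕ.+ t) * ℕ→ℚ (2 ℕ.^ t)        ≡⟨ cong (_* ℕ→ℚ (2 ℕ.^ t)) (^ℚ-homo-+ ½ a t) ⟩
  (2^- a * 2^- t) * ℕ→ℚ (2 ℕ.^ t)      ≡⟨ ℚP.*-assoc (2^- a) (2^- t) _ ⟩
  2^- a * (2^- t * ℕ→ℚ (2 ℕ.^ t))      ≡⟨ cong (2^- a *_) (2^-t*2^t≡1 t) ⟩
  2^- a * 1ℚ                           ≡⟨ ℚP.*-identityʳ _ ⟩
  2^- a                                ∎
  where
  open ≡-Reasoning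
  2^-t*2^t≡1 : ∀ t → 2^- t * ℕ→ℚ (2 ℕ.^ t) ≡ 1ℚ
  2^-t*2^t≡1 zero    = refl
  2^-t*2^t≡1 (suc t) = begin
    (½ * 2^- t) * ℕ→ℚ (2 ℕ.* 2 ℕ.^ t)        ≡⟨ cong ((½ * 2^- t) *_) (ℕ→ℚ-homo-* 2 (2 ℕ.^ t)) ⟩
    (½ * 2^- t) * (ℕ→ℚ 2 * ℕ→ℚ (2 ℕ.^ t))    ≡⟨ solve 3 (λ h x y → (h :* x) :* (con (ℕ→ℚ 2) :* y) := (h :* con (ℕ→ℚ 2)) :* (x :* y))
                                                 refl ½ (2^- t) (ℕ→ℚ (2 ℕ.^ t)) ⟩
    (½ * ℕ→ℚ 2) * (2^- t * ℕ→ℚ (2 ℕ.^ t))    ≡⟨ cong ((½ * ℕ→ℚ 2) *_) (2^-t*2^t≡1 t) ⟩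
    1ℚ                                        ∎
    where open +-*-Solver

+v-+q≤+k : ∀ {v q k} → v ℕ.≤ k ℕ.+ q → ℤ.+ v ℤ.- ℤ.+ q ℤ.≤ ℤ.+ k
+v-+q≤+k {v} {q} {k} v≤k+q =
  ℤP.≤-trans (ℤP.+-monoˡ-≤ (ℤ.- ℤ.+ q) (ℤ.+≤+ v≤k+q)) (ℤP.≤-reflexive [k+q]-q≡k)
  where
  open ℤSolver
  [k+q]-q≡k : ℤ.+ (k ℕ.+ q) ℤ.- ℤ.+ q ≡ ℤ.+ k
  [k+q]-q≡k = trans (cong (ℤ._- ℤ.+ q) (ℤP.pos-+ k q)) (solve 2 (λ a b → (a :+ b) :- b := a) refl (ℤ.+ k) (ℤ.+ q))

1-2^-‿≤1 : ∀ w → 1ℚ - 2^- w ≤ 1ℚ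
1-2^-‿≤1 w = ℚP.≤-trans (ℚP.+-monoʳ-≤ 1ℚ (ℚP.neg-antimono-≤ (2^-‿nonNeg w))) (ℚP.≤-reflexive (ℚP.+-identityʳ 1ℚ))

0<1-2^-‿suc : ∀ w → 0ℚ < 1ℚ - 2^- (suc w)
0<1-2^-‿suc w = ℚP.<-≤-trans (ℚP.positive⁻¹ ½) (ℚP.+-monoʳ-≤ 1ℚ (ℚP.neg-antimono-≤ 2^-[1+w]≤½))
  where
  2^-[1+w]≤½ : 2^- (suc w) ≤ ½
  2^-[1+w]≤½ = ℚP.≤-trans (ℚP.*-monoˡ-≤-nonNeg ½ (^ℚ-≤1 w (ℚP.nonNegative⁻¹ ½) (ℚP.≤ᵇ⇒≤ _)))
                         (ℚP.≤-reflexive (ℚP.*-identityʳ ½))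

[1-2^-w]^k≤[1-2^-w]^[v-q] : ∀ w {v q k} → .{{NonZero w}} → v ℕ.≤ k ℕ.+ q →
  (1ℚ - 2^- w) ^ℚ k ≤ (1ℚ - 2^- w) ^ℤ (ℤ.+ v ℤ.- ℤ.+ q)
[1-2^-w]^k≤[1-2^-w]^[v-q] (suc w) {k = k} v≤k+q = ^ℚ≤^ℤ (0<1-2^-‿suc w) (1-2^-‿≤1 (suc w)) k (+v-+q≤+k v≤k+q)

[1-2^-w]^[v-q]-nonNeg : ∀ w v q → .{{NonZero w}} → 0ℚ ≤ (1ℚ - 2^- w) ^ℤ (ℤ.+ v ℤ.- ℤ.+ q)
[1-2^-w]^[v-q]-nonNeg w@(suc w′) v q = ℚP.≤-trans (^ℚ-nonNeg v (ℚP.<⇒≤ (0<1-2^-‿suc w′)))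
  ([1-2^-w]^k≤[1-2^-w]^[v-q] w {v} {q} {v} (ℕP.m≤m+n v q))

∑-mono-≤ : {A : Set} (xs : List A) {f g : A → ℚ} → (∀ x → f x ≤ g x) → ∑ xs f ≤ ∑ xs g
∑-mono-≤ []       f≤g = ℚP.≤-refl
∑-mono-≤ (x ∷ xs) f≤g = ℚP.+-mono-≤ (f≤g x) (∑-mono-≤ xs f≤g)

∑-nonNeg : {A : Set} (xs : List A) {f : A → ℚ} → (∀ x → 0ℚ ≤ f x) → 0ℚ ≤ ∑ xs f
∑-nonNeg xs {f} 0≤f = subst (_≤ ∑ xs f) (∑-zero xs) (∑-mono-≤ xs 0≤f)

ℕ→ℚ-∑ : {A : Set} (xs : List A) (f : A → ℕ) → ℕ→ℚ (ℕ∑.∑ xs f) ≡ ∑ xs (ℕ→ℚ ∘ f)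
ℕ→ℚ-∑ []       f = refl
ℕ→ℚ-∑ (x ∷ xs) f = trans (ℕ→ℚ-homo-+ (f x) _) (cong (ℕ→ℚ (f x) +_) (ℕ→ℚ-∑ xs f))

∑-const : {A : Set} (xs : List A) (a : ℚ) → ∑ xs (λ _ → a) ≡ ℕ→ℚ (length xs) * a
∑-const []       a = sym (ℚP.*-zeroˡ a)
∑-const (x ∷ xs) a = begin
  a + ∑ xs (λ _ → a)              ≡⟨ cong (a +_) (∑-const xs a) ⟩
  a + ℕ→ℚ (length xs) * a          ≡⟨ cong (_+ ℕ→ℚ (length xs) * a) (sym (ℚP.*-identityˡ a)) ⟩
  1ℚ * a + ℕ→ℚ (length xs) * a     ≡⟨ sym (ℚP.*-distribʳ-+ a 1ℚ (ℕ→ℚ (length xs))) ⟩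
  (1ℚ + ℕ→ℚ (length xs)) * a       ≡⟨ cong (_* a) (sym (ℕ→ℚ-homo-+ 1 (length xs))) ⟩
  ℕ→ℚ (length (x ∷ xs)) * a        ∎
  where open ≡-Reasoning

sum-map≡∑ : {A : Set} (f : A → ℕ) (xs : List A) → sum (map f xs) ≡ ℕ∑.∑ xs f
sum-map≡∑ f []       = refl
sum-map≡∑ f (x ∷ xs) = cong (f x ℕ.+_) (sum-map≡∑ f xs)

foldr-⊔-≤ : ∀ {r} (xs : List ℚ) → 0ℚ ≤ r → All (_≤ r) xs → foldr _⊔_ 0ℚ xs ≤ r
foldr-⊔-≤ []       0≤r []            = 0≤r
foldr-⊔-≤ (x ∷ xs) 0≤r (x≤r ∷ xs≤r) = ℚP.⊔-lub x≤r (foldr-⊔-≤ xs 0≤r xs≤r)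

𝟙ℕ : Bool → ℕ
𝟙ℕ true  = 1
𝟙ℕ false = 0

𝟙 : Bool → ℚ
𝟙 true  = 1ℚ
𝟙 false = 0ℚ

countᵇ≡∑ : {A : Set} (p : A → Bool) (xs : List A) → countᵇ p xs ≡ ℕ∑.∑ xs (𝟙ℕ ∘ p)
countᵇ≡∑ p []       = refl
countᵇ≡∑ p (x ∷ xs) with p x
... | true  = cong suc (countᵇ≡∑ p xs)
... | false = countᵇ≡∑ p xs

ℕ→ℚ-countᵇ : {A : Set} (p : A → Bool) (xs : List A) → ℕ→ℚ (countᵇ p xs) ≡ ∑ xs (𝟙 ∘ p)
ℕ→ℚ-countᵇ p xs = trans (cong ℕ→ℚ (countᵇ≡∑ p xs))
  (trans (ℕ→ℚ-∑ xs (𝟙ℕ ∘ p)) (∑-cong xs (λ x → ℕ→ℚ-𝟙ℕ (p x))))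
  where
  ℕ→ℚ-𝟙ℕ : ∀ b → ℕ→ℚ (𝟙ℕ b) ≡ 𝟙 b
  ℕ→ℚ-𝟙ℕ true  = refl
  ℕ→ℚ-𝟙ℕ false = refl

𝟙-nonNeg : ∀ b → 0ℚ ≤ 𝟙 b
𝟙-nonNeg true  = ℚP.nonNegative⁻¹ 1ℚ
𝟙-nonNeg false = ℚP.≤-refl

𝟙-∧ : ∀ a b → 𝟙 (a ∧ b) ≡ 𝟙 a * 𝟙 b
𝟙-∧ true  b = sym (ℚP.*-identityˡ (𝟙 b))
𝟙-∧ false b = sym (ℚP.*-zeroˡ (𝟙 b))

𝟙-mono : ∀ {a b} → (T a → T b) → 𝟙 a ≤ 𝟙 b
𝟙-mono {false} {b}    _   = 𝟙-nonNeg b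
𝟙-mono {true}  {true} _   = ℚP.≤-refl
𝟙-mono {true}  {false} a⇒b = ⊥-elim (a⇒b tt)

𝟙-any≤∑ : {A : Set} (p : A → Bool) (xs : List A) → 𝟙 (any p xs) ≤ ∑ xs (𝟙 ∘ p)
𝟙-any≤∑ p []       = ℚP.≤-refl
𝟙-any≤∑ p (x ∷ xs) with p x
... | true  = ℚP.≤-trans (ℚP.≤-reflexive (sym (ℚP.+-identityʳ 1ℚ)))
                (ℚP.+-monoʳ-≤ 1ℚ (∑-nonNeg xs (𝟙-nonNeg ∘ p)))
... | false = ℚP.≤-trans (𝟙-any≤∑ p xs) (ℚP.≤-reflexive (sym (ℚP.+-identityˡ _)))

T-not⇒¬T : ∀ {b} → T (not b) → ¬ T b
T-not⇒¬T {true} () _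

¬T⇒T-not : ∀ {b} → ¬ T b → T (not b)
¬T⇒T-not {true}  ¬b = ¬b tt
¬T⇒T-not {false} _  = tt

switches : ∀ a b → T (not (a ==ᵇ b)) → (T a × ¬ T b) ⊎ (¬ T a × T b)
switches true  false _ = inj₁ (tt , λ ())
switches false true  _ = inj₂ ((λ ()) , tt)

module _ {n : ℕ} {p : Fin n → Bool} where

  all-allFin⁺ : T (all p (allFin n)) → ∀ i → T (p i)
  all-allFin⁺ h i = All.lookup (all⁺ p (allFin n) h) (∈-allFin i)

  all-allFin⁻ : (∀ i → T (p i)) → T (all p (allFin n))
  all-allFin⁻ h = all⁻ p (AllP.tabulate⁺ h)

  any-allFin⁺ : ∀ i → T (p i) → T (any p (allFin n))
  any-allFin⁺ i h = any⁺ p (AnyP.map (λ { refl → h }) (∈-allFin i))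

  any-allFin⁻ : T (any p (allFin n)) → ∃ λ i → T (p i)
  any-allFin⁻ h = satisfied (any⁻ p (allFin n) h)

  ¬all-allFin : ¬ T (all p (allFin n)) → ∃ λ i → ¬ T (p i)
  ¬all-allFin h = satisfied (¬All⇒Any¬ (T? ∘ p) (allFin n) (h ∘ all⁻ p))

countᵇ≡0⇒¬T : {A : Set} (p : A → Bool) (xs : List A) → countᵇ p xs ≡ 0 → ∀ {x} → x ∈ xs → ¬ T (p x)
countᵇ≡0⇒¬T p (y ∷ ys) c≡0 x∈ with p y in eq
countᵇ≡0⇒¬T p (y ∷ ys) ()  x∈          | true
countᵇ≡0⇒¬T p (y ∷ ys) c≡0 (here refl) | false = subst T eq
countᵇ≡0⇒¬T p (y ∷ ys) c≡0 (there x∈)  | false = countᵇ≡0⇒¬T p ys c≡0 x∈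

countᵇ-∖-∩ : {A : Set} (S Q : A → Bool) (xs : List A) →
  countᵇ S xs ≡ countᵇ (λ x → S x ∧ not (Q x)) xs ℕ.+ countᵇ (λ x → Q x ∧ S x) xs
countᵇ-∖-∩ S Q []       = refl
countᵇ-∖-∩ S Q (x ∷ xs) with S x | Q x
... | true  | true  = trans (cong suc (countᵇ-∖-∩ S Q xs)) (sym (ℕP.+-suc _ _))
... | true  | false = cong suc (countᵇ-∖-∩ S Q xs)
... | false | true  = countᵇ-∖-∩ S Q xs
... | false | false = countᵇ-∖-∩ S Q xs

countᵇ+countᵇ-not : {A : Set} (p : A → Bool) (xs : List A) → countᵇ p xs ℕ.+ countᵇ (not ∘ p) xs ≡ length xs
countᵇ+countᵇ-not p []       = refl
countᵇ+countᵇ-not p (x ∷ xs) with p x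
... | true  = cong suc (countᵇ+countᵇ-not p xs)
... | false = trans (ℕP.+-suc _ _) (cong suc (countᵇ+countᵇ-not p xs))

countᵇ-nonzero≤∑ : {A : Set} (t : A → ℕ) (xs : List A) → countᵇ (λ x → not (t x ≡ᵇ 0)) xs ℕ.≤ ℕ∑.∑ xs t
countᵇ-nonzero≤∑ t []       = ℕ.z≤n
countᵇ-nonzero≤∑ t (x ∷ xs) with t x
... | zero  = countᵇ-nonzero≤∑ t xs
... | suc m = ℕ.s≤s (ℕP.≤-trans (countᵇ-nonzero≤∑ t xs) (ℕP.m≤n+m _ m))

-- Uniform expectation

𝔼 : (n : ℕ) → (Assign n → ℚ) → ℚ
𝔼 n g = ∑ (allAssign n) g * 2^- n

I-Q≡𝔼 : ∀ {n} (f : Assign n → Bool) (Q : Assign n) → I-Q f Q ≡ 𝔼 n (𝟙 ∘ undetermined f Q)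
I-Q≡𝔼 {n} f Q = cong (_* 2^- n) (ℕ→ℚ-countᵇ (undetermined f Q) (allAssign n))

𝔼-cong : ∀ n {g h : Assign n → ℚ} → (∀ x → g x ≡ h x) → 𝔼 n g ≡ 𝔼 n h
𝔼-cong n g≗h = cong (_* 2^- n) (∑-cong (allAssign n) g≗h)

𝔼-mono-≤ : ∀ n {g h : Assign n → ℚ} → (∀ x → g x ≤ h x) → 𝔼 n g ≤ 𝔼 n h
𝔼-mono-≤ n g≤h = ℚP.*-monoʳ-≤-nonNeg (2^- n) {{ℚ.nonNegative (2^-‿nonNeg n)}} (∑-mono-≤ (allAssign n) g≤h)

𝔼-*ˡ : ∀ n a (g : Assign n → ℚ) → 𝔼 n (λ x → a * g x) ≡ a * 𝔼 n g
𝔼-*ˡ n a g = trans (cong (_* 2^- n) (∑-distribˡ-* (allAssign n) a g)) (ℚP.*-assoc a _ (2^- n))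

𝔼-distrib-+ : ∀ n (g h : Assign n → ℚ) → 𝔼 n (λ x → g x + h x) ≡ 𝔼 n g + 𝔼 n h
𝔼-distrib-+ n g h = trans (cong (_* 2^- n) (∑-distrib-+ (allAssign n) g h))
  (ℚP.*-distribʳ-+ (2^- n) (∑ (allAssign n) g) (∑ (allAssign n) h))

𝔼-∑ : {A : Set} (n : ℕ) (xs : List A) (g : A → Assign n → ℚ) →
  𝔼 n (λ x → ∑ xs (λ a → g a x)) ≡ ∑ xs (λ a → 𝔼 n (g a))
𝔼-∑ n xs g = begin
  ∑ (allAssign n) (λ x → ∑ xs (λ a → g a x)) * 2^- n   ≡⟨ cong (_* 2^- n) (∑-comm (allAssign n) xs (λ x a → g a x)) ⟩
  ∑ xs (λ a → ∑ (allAssign n) (g a)) * 2^- n            ≡⟨ ℚP.*-comm _ (2^- n) ⟩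
  2^- n * ∑ xs (λ a → ∑ (allAssign n) (g a))            ≡⟨ sym (∑-distribˡ-* xs (2^- n) _) ⟩
  ∑ xs (λ a → 2^- n * ∑ (allAssign n) (g a))            ≡⟨ ∑-cong xs (λ a → ℚP.*-comm (2^- n) _) ⟩
  ∑ xs (λ a → 𝔼 n (g a))                                ∎
  where open ≡-Reasoning

𝔼-cons : ∀ n (g : Assign (suc n) → ℚ) →
  𝔼 (suc n) g ≡ ½ * (𝔼 n (g ∘ (false VF.∷_)) + 𝔼 n (g ∘ (true VF.∷_)))
𝔼-cons n g = begin
  ∑ (allAssign (suc n)) g * (½ * 2^- n)                      ≡⟨ cong (_* (½ * 2^- n)) ∑-split ⟩
  (∑ (allAssign n) g₀ + ∑ (allAssign n) g₁) * (½ * 2^- n)    ≡⟨ solve 4 (λ a b h p → (a :+ b) :* (h :* p) := h :* (a :* p :+ b :* p))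
                                                                  refl (∑ (allAssign n) g₀) (∑ (allAssign n) g₁) ½ (2^- n) ⟩
  ½ * (𝔼 n g₀ + 𝔼 n g₁)                                       ∎
  where
  open ≡-Reasoning
  open +-*-Solver
  g₀ g₁ : Assign n → ℚ
  g₀ = g ∘ (false VF.∷_)
  g₁ = g ∘ (true VF.∷_)
  ∑-split : ∑ (allAssign (suc n)) g ≡ ∑ (allAssign n) g₀ + ∑ (allAssign n) g₁
  ∑-split = trans (∑-concatMap _ (allAssign n) g)
    (trans (∑-cong (allAssign n) (λ x → cong (g₀ x +_) (ℚP.+-identityʳ (g₁ x))))
           (∑-distrib-+ (allAssign n) g₀ g₁))

𝔼-const : ∀ n a → 𝔼 n (λ _ → a) ≡ a
𝔼-const zero    a = trans (ℚP.*-identityʳ _) (ℚP.+-identityʳ a)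
𝔼-const (suc n) a = begin
  𝔼 (suc n) (λ _ → a)                  ≡⟨ 𝔼-cons n (λ _ → a) ⟩
  ½ * (𝔼 n (λ _ → a) + 𝔼 n (λ _ → a))  ≡⟨ cong (λ b → ½ * (b + b)) (𝔼-const n a) ⟩
  ½ * (a + a)                          ≡⟨ ½*[x+x]≡x a ⟩
  a                                    ∎
  where open ≡-Reasoning

𝔼-nonNeg : ∀ n {g : Assign n → ℚ} → (∀ x → 0ℚ ≤ g x) → 0ℚ ≤ 𝔼 n g
𝔼-nonNeg n {g} 0≤g = subst (_≤ 𝔼 n g) (𝔼-const n 0ℚ) (𝔼-mono-≤ n 0≤g)

𝔼-𝟙-not : ∀ n (e : Assign n → Bool) → 𝔼 n (𝟙 ∘ not ∘ e) ≡ 1ℚ - 𝔼 n (𝟙 ∘ e)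
𝔼-𝟙-not n e = begin
  𝔼 n (𝟙 ∘ not ∘ e)                                   ≡⟨ solve 2 (λ a b → a := (a :+ b) :- b) refl (𝔼 n (𝟙 ∘ not ∘ e)) (𝔼 n (𝟙 ∘ e)) ⟩
  (𝔼 n (𝟙 ∘ not ∘ e) + 𝔼 n (𝟙 ∘ e)) - 𝔼 n (𝟙 ∘ e)     ≡⟨ cong (_- 𝔼 n (𝟙 ∘ e)) (sym (𝔼-distrib-+ n (𝟙 ∘ not ∘ e) (𝟙 ∘ e))) ⟩
  𝔼 n (λ x → 𝟙 (not (e x)) + 𝟙 (e x)) - 𝔼 n (𝟙 ∘ e)  ≡⟨ cong (_- 𝔼 n (𝟙 ∘ e)) (trans (𝔼-cong n (𝟙-not+𝟙 ∘ e)) (𝔼-const n 1ℚ)) ⟩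
  1ℚ - 𝔼 n (𝟙 ∘ e)                                    ∎
  where
  open ≡-Reasoning
  open +-*-Solver
  𝟙-not+𝟙 : ∀ b → 𝟙 (not b) + 𝟙 b ≡ 1ℚ
  𝟙-not+𝟙 true  = refl
  𝟙-not+𝟙 false = refl

-- Independence

DependsOnlyOn : ∀ {n} {A : Set} → Assign n → (Assign n → A) → Set
DependsOnlyOn S g = ∀ x y → (∀ ℓ → T (S ℓ) → x ℓ ≡ y ℓ) → g x ≡ g y

Disjoint : ∀ {n} → Assign n → Assign n → Set
Disjoint S S′ = ∀ ℓ → T (S ℓ) → ¬ T (S′ ℓ)

dependsOnlyOn-∘ : ∀ {n} {A B : Set} {S : Assign n} {g : Assign n → A} (f : A → B) →
  DependsOnlyOn S g → DependsOnlyOn S (f ∘ g)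
dependsOnlyOn-∘ f dep x y agree = cong f (dep x y agree)

dependsOnlyOn-mono : ∀ {n} {A : Set} {S S′ : Assign n} {g : Assign n → A} → (∀ ℓ → T (S ℓ) → T (S′ ℓ)) →
  DependsOnlyOn S g → DependsOnlyOn S′ g
dependsOnlyOn-mono S⊆S′ dep x y agree = dep x y (λ ℓ ℓ∈S → agree ℓ (S⊆S′ ℓ ℓ∈S))

dependsOnlyOn-tail : ∀ {n} {A : Set} {S : Assign (suc n)} {g : Assign (suc n) → A} → DependsOnlyOn S g →
  ∀ b → DependsOnlyOn (S ∘ suc) (g ∘ (b VF.∷_))
dependsOnlyOn-tail dep b x y agree = dep (b VF.∷ x) (b VF.∷ y) λ where
  zero    _    → refl
  (suc ℓ) ℓ∈S → agree ℓ ℓ∈S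

dependsOnlyOn-head : ∀ {n} {A : Set} {S : Assign (suc n)} {g : Assign (suc n) → A} → DependsOnlyOn S g → ¬ T (S zero) →
  ∀ x → g (false VF.∷ x) ≡ g (true VF.∷ x)
dependsOnlyOn-head dep 0∉S x = dep (false VF.∷ x) (true VF.∷ x) λ where
  zero    0∈S  → ⊥-elim (0∉S 0∈S)
  (suc ℓ) _    → refl

-- Induction on n: the first coordinate is irrelevant to at least one of the two factors.
𝔼-*-disjoint : ∀ n {S S′ : Assign n} {g h : Assign n → ℚ} → Disjoint S S′ →
  DependsOnlyOn S g → DependsOnlyOn S′ h → 𝔼 n (λ x → g x * h x) ≡ 𝔼 n g * 𝔼 n h

𝔼-*-disjoint-headFree : ∀ n {S S′ : Assign (suc n)} {g h : Assign (suc n) → ℚ} → Disjoint S S′ →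
  DependsOnlyOn S g → DependsOnlyOn S′ h → (∀ x → g (false VF.∷ x) ≡ g (true VF.∷ x)) →
  𝔼 (suc n) (λ x → g x * h x) ≡ 𝔼 (suc n) g * 𝔼 (suc n) h
𝔼-*-disjoint-headFree n {S} {S′} {g} {h} S#S′ dg dh g₀≗g₁ = begin
  𝔼 (suc n) (λ x → g x * h x)                     ≡⟨ 𝔼-cons n _ ⟩
  ½ * (𝔼 n (λ x → g₀ x * h₀ x) + 𝔼 n (λ x → g₁ x * h₁ x))
    ≡⟨ cong (λ e → ½ * (𝔼 n (λ x → g₀ x * h₀ x) + e)) (𝔼-cong n (λ x → cong (_* h₁ x) (sym (g₀≗g₁ x)))) ⟩
  ½ * (𝔼 n (λ x → g₀ x * h₀ x) + 𝔼 n (λ x → g₀ x * h₁ x))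
    ≡⟨ cong₂ (λ a b → ½ * (a + b)) (𝔼-*-disjoint n tail# (dependsOnlyOn-tail dg false) (dependsOnlyOn-tail dh false))
                                    (𝔼-*-disjoint n tail# (dependsOnlyOn-tail dg false) (dependsOnlyOn-tail dh true)) ⟩
  ½ * (𝔼 n g₀ * 𝔼 n h₀ + 𝔼 n g₀ * 𝔼 n h₁)
    ≡⟨ solve 3 (λ a b c → con ½ :* (a :* b :+ a :* c) := (con ½ :* (a :+ a)) :* (con ½ :* (b :+ c))) refl (𝔼 n g₀) (𝔼 n h₀) (𝔼 n h₁) ⟩
  (½ * (𝔼 n g₀ + 𝔼 n g₀)) * (½ * (𝔼 n h₀ + 𝔼 n h₁))
    ≡⟨ cong₂ _*_ (trans (cong (λ e → ½ * (𝔼 n g₀ + e)) (𝔼-cong n g₀≗g₁)) (sym (𝔼-cons n g))) (sym (𝔼-cons n h)) ⟩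
  𝔼 (suc n) g * 𝔼 (suc n) h                       ∎
  where
  open ≡-Reasoning
  open +-*-Solver
  g₀ g₁ h₀ h₁ : Assign n → ℚ
  g₀ = g ∘ (false VF.∷_)
  g₁ = g ∘ (true VF.∷_)
  h₀ = h ∘ (false VF.∷_)
  h₁ = h ∘ (true VF.∷_)
  tail# : Disjoint (S ∘ suc) (S′ ∘ suc)
  tail# ℓ = S#S′ (suc ℓ)

𝔼-*-disjoint zero {g = g} {h} _ _ _ =
  solve 2 (λ a b → (a :* b :+ con 0ℚ) :* con 1ℚ := ((a :+ con 0ℚ) :* con 1ℚ) :* ((b :+ con 0ℚ) :* con 1ℚ))
    refl (g (λ ())) (h (λ ()))
  where open +-*-Solver
𝔼-*-disjoint (suc n) {S} {g = g} {h} S#S′ dg dh with T? (S zero)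
... | no  0∉S = 𝔼-*-disjoint-headFree n S#S′ dg dh (dependsOnlyOn-head dg 0∉S)
... | yes 0∈S = begin
  𝔼 (suc n) (λ x → g x * h x) ≡⟨ 𝔼-cong (suc n) (λ x → ℚP.*-comm (g x) (h x)) ⟩
  𝔼 (suc n) (λ x → h x * g x) ≡⟨ 𝔼-*-disjoint-headFree n (λ ℓ ℓ∈S′ ℓ∈S → S#S′ ℓ ℓ∈S ℓ∈S′) dh dg
                                   (dependsOnlyOn-head dh (S#S′ zero 0∈S)) ⟩
  𝔼 (suc n) h * 𝔼 (suc n) g   ≡⟨ ℚP.*-comm (𝔼 (suc n) h) (𝔼 (suc n) g) ⟩
  𝔼 (suc n) g * 𝔼 (suc n) h   ∎
  where open ≡-Reasoning

allOnesOn : ∀ {n} → Assign n → Assign n → Bool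
allOnesOn {n} S x = all (λ ℓ → not (S ℓ) ∨ x ℓ) (allFin n)

all-allFin-suc : ∀ {n} (p : Fin (suc n) → Bool) → all p (allFin (suc n)) ≡ p zero ∧ all (p ∘ suc) (allFin n)
all-allFin-suc p = cong (λ bs → p zero ∧ and bs) (trans (map-tabulate suc p) (sym (map-tabulate id (p ∘ suc))))

allOnesOn-cons : ∀ {n} (S : Assign (suc n)) b x →
  allOnesOn S (b VF.∷ x) ≡ (not (S zero) ∨ b) ∧ allOnesOn (S ∘ suc) x
allOnesOn-cons S b x = all-allFin-suc (λ ℓ → not (S ℓ) ∨ (b VF.∷ x) ℓ)

∣∣-cons : ∀ {n} (S : Assign (suc n)) → ∣ S ∣ ≡ 𝟙ℕ (S zero) ℕ.+ ∣ S ∘ suc ∣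
∣∣-cons {n} S = begin
  countᵇ S (allFin (suc n))                                  ≡⟨ countᵇ≡∑ S (allFin (suc n)) ⟩
  𝟙ℕ (S zero) ℕ.+ ℕ∑.∑ (tabulate suc) (𝟙ℕ ∘ S)               ≡⟨ cong (𝟙ℕ (S zero) ℕ.+_) (ℕ∑.∑-tabulate suc (𝟙ℕ ∘ S)) ⟩
  𝟙ℕ (S zero) ℕ.+ ℕ∑.∑ (allFin n) (𝟙ℕ ∘ S ∘ suc)             ≡⟨ cong (𝟙ℕ (S zero) ℕ.+_) (sym (countᵇ≡∑ (S ∘ suc) (allFin n))) ⟩
  𝟙ℕ (S zero) ℕ.+ ∣ S ∘ suc ∣                                 ∎
  where open ≡-Reasoning

𝔼-allOnesOn : ∀ n (S : Assign n) → 𝔼 n (𝟙 ∘ allOnesOn S) ≡ 2^- ∣ S ∣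
𝔼-allOnesOn zero    S = refl
𝔼-allOnesOn (suc n) S = begin
  𝔼 (suc n) (𝟙 ∘ allOnesOn S)
    ≡⟨ 𝔼-cons n _ ⟩
  ½ * (𝔼 n (λ x → 𝟙 (allOnesOn S (false VF.∷ x))) + 𝔼 n (λ x → 𝟙 (allOnesOn S (true VF.∷ x))))
    ≡⟨ cong₂ (λ a b → ½ * (a + b)) (𝔼-cong n (λ x → cong 𝟙 (allOnesOn-cons S false x)))
                                    (𝔼-cong n (λ x → cong 𝟙 (allOnesOn-cons S true x))) ⟩
  ½ * (𝔼 n (λ x → 𝟙 ((not (S zero) ∨ false) ∧ A x)) + 𝔼 n (λ x → 𝟙 ((not (S zero) ∨ true) ∧ A x)))
    ≡⟨ byHead (S zero) ⟩
  2^- (𝟙ℕ (S zero) ℕ.+ ∣ S ∘ suc ∣)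
    ≡⟨ cong 2^-_ (sym (∣∣-cons S)) ⟩
  2^- ∣ S ∣ ∎
  where
  open ≡-Reasoning
  A : Assign n → Bool
  A = allOnesOn (S ∘ suc)
  byHead : ∀ b → ½ * (𝔼 n (λ x → 𝟙 ((not b ∨ false) ∧ A x)) + 𝔼 n (λ x → 𝟙 ((not b ∨ true) ∧ A x)))
                 ≡ 2^- (𝟙ℕ b ℕ.+ ∣ S ∘ suc ∣)
  byHead true  = cong (½ *_) (trans (cong₂ _+_ (𝔼-const n 0ℚ) (𝔼-allOnesOn n (S ∘ suc))) (ℚP.+-identityˡ (2^- ∣ S ∘ suc ∣)))
  byHead false = trans (½*[x+x]≡x _) (𝔼-allOnesOn n (S ∘ suc))

allOnesOn⁺ : ∀ {n} {S x : Assign n} → T (allOnesOn S x) → ∀ ℓ → T (S ℓ) → T (x ℓ)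
allOnesOn⁺ {S = S} h ℓ ℓ∈S with S ℓ | all-allFin⁺ h ℓ
... | true | xℓ = xℓ

allOnesOn⁻ : ∀ {n} {S x : Assign n} → (∀ ℓ → T (S ℓ) → T (x ℓ)) → T (allOnesOn S x)
allOnesOn⁻ {S = S} {x} h = all-allFin⁻ λ ℓ → onBit ℓ
  where
  onBit : ∀ ℓ → T (not (S ℓ) ∨ x ℓ)
  onBit ℓ with S ℓ in eq
  ... | true  = h ℓ (Equivalence.from T-≡ eq)
  ... | false = tt

allOnesOn-dependsOnlyOn : ∀ {n} (S : Assign n) → DependsOnlyOn S (allOnesOn S)
allOnesOn-dependsOnlyOn {n} S x y agree = cong and (map-cong onBit (allFin n))
  where
  onBit : ∀ ℓ → (not (S ℓ) ∨ x ℓ) ≡ (not (S ℓ) ∨ y ℓ)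
  onBit ℓ with S ℓ in eq
  ... | true  = agree ℓ (Equivalence.from T-≡ eq)
  ... | false = refl

blockOf : ∀ {n v} → (Fin n → Fin v) → Fin v → Assign n
blockOf blk j ℓ = ⌊ blk ℓ ≟ᶠ j ⌋

unionOf : ∀ {n v} → (Fin n → Fin v) → List (Fin v) → Assign n
unionOf blk L ℓ = any (λ k → blockOf blk k ℓ) L

blocks-disjoint : ∀ {n v} (blk : Fin n → Fin v) {j k} → j ≢ k → Disjoint (blockOf blk j) (blockOf blk k)
blocks-disjoint blk j≢k ℓ ℓ∈j ℓ∈k = j≢k (trans (sym (toWitness ℓ∈j)) (toWitness ℓ∈k))

block-disjoint-union : ∀ {n v} (blk : Fin n → Fin v) {k L} → All (k ≢_) L → Disjoint (blockOf blk k) (unionOf blk L)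
block-disjoint-union blk (k≢k′ ∷ k∉L) ℓ ℓ∈k ℓ∈k′∪L with Equivalence.to T-∨ ℓ∈k′∪L
... | inj₁ ℓ∈k′ = blocks-disjoint blk k≢k′ ℓ ℓ∈k ℓ∈k′
... | inj₂ ℓ∈L  = block-disjoint-union blk k∉L ℓ ℓ∈k ℓ∈L

dependsOnlyOn-all : ∀ {n v} (blk : Fin n → Fin v) {e : Fin v → Assign n → Bool} →
  (∀ k → DependsOnlyOn (blockOf blk k) (e k)) → ∀ L → DependsOnlyOn (unionOf blk L) (λ x → all (λ k → e k x) L)
dependsOnlyOn-all blk dep []      x y agree = refl
dependsOnlyOn-all blk dep (k ∷ L) x y agree = cong₂ _∧_
  (dep k x y (λ ℓ ℓ∈k → agree ℓ (Equivalence.from T-∨ (inj₁ ℓ∈k))))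
  (dependsOnlyOn-all blk dep L x y (λ ℓ ℓ∈L → agree ℓ (Equivalence.from T-∨ (inj₂ ℓ∈L))))

𝔼-all-blocks : ∀ n {v} (blk : Fin n → Fin v) {e : Fin v → Assign n → Bool} {p : ℚ} →
  (∀ k → DependsOnlyOn (blockOf blk k) (e k)) → (∀ k → 𝔼 n (𝟙 ∘ e k) ≡ p) →
  ∀ {L} → Unique L → 𝔼 n (λ x → 𝟙 (all (λ k → e k x) L)) ≡ p ^ℚ length L
𝔼-all-blocks n blk dep 𝔼e≡p {[]}    []          = 𝔼-const n 1ℚ
𝔼-all-blocks n blk {e} {p} dep 𝔼e≡p {k ∷ L} (k∉L ∷ uniqueL) = begin
  𝔼 n (λ x → 𝟙 (e k x ∧ all (λ k → e k x) L))
    ≡⟨ 𝔼-cong n (λ x → 𝟙-∧ (e k x) _) ⟩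
  𝔼 n (λ x → 𝟙 (e k x) * 𝟙 (all (λ k → e k x) L))
    ≡⟨ 𝔼-*-disjoint n (block-disjoint-union blk k∉L) (dependsOnlyOn-∘ 𝟙 (dep k))
                      (dependsOnlyOn-∘ 𝟙 (dependsOnlyOn-all blk dep L)) ⟩
  𝔼 n (𝟙 ∘ e k) * 𝔼 n (λ x → 𝟙 (all (λ k → e k x) L))
    ≡⟨ cong₂ _*_ (𝔼e≡p k) (𝔼-all-blocks n blk dep 𝔼e≡p uniqueL) ⟩
  p * p ^ℚ length L ∎
  where open ≡-Reasoning

_∩_ _∖_ : ∀ {n} → Assign n → Assign n → Assign n
(S ∩ Q) ℓ = S ℓ ∧ Q ℓ
(S ∖ Q) ℓ = S ℓ ∧ not (Q ℓ)

∑-one-hot : ∀ {v} (i : Fin v) → ℕ∑.∑ (allFin v) (λ k → 𝟙ℕ ⌊ i ≟ᶠ k ⌋) ≡ 1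
∑-one-hot {suc v} zero    =
  cong suc (trans (ℕ∑.∑-tabulate {n = v} Fin.suc (λ k → 𝟙ℕ ⌊ zero ≟ᶠ k ⌋)) (ℕ∑.∑-zero (allFin v)))
∑-one-hot {suc v} (suc i) = trans (ℕ∑.∑-tabulate {n = v} Fin.suc (λ k → 𝟙ℕ ⌊ suc i ≟ᶠ k ⌋))
  (trans (ℕ∑.∑-cong (allFin v) (λ k → cong 𝟙ℕ (suc≟suc k))) (∑-one-hot i))
  where
  suc≟suc : ∀ k → ⌊ Fin.suc i ≟ᶠ suc k ⌋ ≡ ⌊ i ≟ᶠ k ⌋
  suc≟suc k with i ≟ᶠ k
  ... | yes _ = refl
  ... | no  _ = refl

-- Double counting: every element lies in exactly one block.
∑-∣∩block∣ : ∀ {n v} (blk : Fin n → Fin v) (Q : Assign n) → ℕ∑.∑ (allFin v) (λ k → ∣ Q ∩ blockOf blk k ∣) ≡ ∣ Q ∣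
∑-∣∩block∣ {n} {v} blk Q = begin
  ℕ∑.∑ (allFin v) (λ k → ∣ Q ∩ blockOf blk k ∣)                       ≡⟨ ℕ∑.∑-cong (allFin v) (λ k → countᵇ≡∑ _ (allFin n)) ⟩
  ℕ∑.∑ (allFin v) (λ k → ℕ∑.∑ (allFin n) (λ ℓ → 𝟙ℕ (Q ℓ ∧ blockOf blk k ℓ))) ≡⟨ ℕ∑.∑-comm (allFin v) (allFin n) _ ⟩
  ℕ∑.∑ (allFin n) (λ ℓ → ℕ∑.∑ (allFin v) (λ k → 𝟙ℕ (Q ℓ ∧ blockOf blk k ℓ))) ≡⟨ ℕ∑.∑-cong (allFin n) inBlocks ⟩
  ℕ∑.∑ (allFin n) (𝟙ℕ ∘ Q)                                                 ≡⟨ sym (countᵇ≡∑ Q (allFin n)) ⟩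
  ∣ Q ∣                                                                   ∎
  where
  open ≡-Reasoning
  inBlocks : ∀ ℓ → ℕ∑.∑ (allFin v) (λ k → 𝟙ℕ (Q ℓ ∧ blockOf blk k ℓ)) ≡ 𝟙ℕ (Q ℓ)
  inBlocks ℓ with Q ℓ
  ... | true  = ∑-one-hot (blk ℓ)
  ... | false = ℕ∑.∑-zero (allFin v)

disjointBlocks : ∀ {n v} → (Fin n → Fin v) → Assign n → List (Fin v)
disjointBlocks {v = v} blk Q = filterᵇ (λ k → ∣ Q ∩ blockOf blk k ∣ ≡ᵇ 0) (allFin v)

∈disjointBlocks⇒≡0 : ∀ {n v} (blk : Fin n → Fin v) (Q : Assign n) {k} → k ∈ disjointBlocks blk Q → ∣ Q ∩ blockOf blk k ∣ ≡ 0
∈disjointBlocks⇒≡0 blk Q {k} k∈L =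
  ℕP.≡ᵇ⇒≡ ∣ Q ∩ blockOf blk k ∣ 0 (proj₂ (∈-filter⁻ (λ k → T? (∣ Q ∩ blockOf blk k ∣ ≡ᵇ 0)) {xs = allFin _} k∈L))

-- A block meeting Q contains an element of Q.
v≤∣disjointBlocks∣+∣Q∣ : ∀ {n v} (blk : Fin n → Fin v) (Q : Assign n) → v ℕ.≤ length (disjointBlocks blk Q) ℕ.+ ∣ Q ∣
v≤∣disjointBlocks∣+∣Q∣ {n} {v} blk Q = begin
  v                                                 ≡⟨ sym (trans (countᵇ+countᵇ-not p (allFin v)) (length-tabulate id)) ⟩
  countᵇ p (allFin v) ℕ.+ countᵇ (not ∘ p) (allFin v) ≤⟨ ℕP.+-monoʳ-≤ (countᵇ p (allFin v)) (countᵇ-nonzero≤∑ t (allFin v)) ⟩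
  countᵇ p (allFin v) ℕ.+ ℕ∑.∑ (allFin v) t          ≡⟨ cong (countᵇ p (allFin v) ℕ.+_) (∑-∣∩block∣ blk Q) ⟩
  length (disjointBlocks blk Q) ℕ.+ ∣ Q ∣             ∎
  where
  open ℕP.≤-Reasoning
  t : Fin v → ℕ
  t k = ∣ Q ∩ blockOf blk k ∣
  p : Fin v → Bool
  p k = t k ≡ᵇ 0

-- Critical blocks

AgreeOutside : ∀ {n} → Assign n → Assign n → Assign n → Set
AgreeOutside Q x y = ∀ ℓ → ¬ T (Q ℓ) → y ℓ ≡ x ℓ

agreeOutside⇒AgreeOutside : ∀ {n} {Q x y : Assign n} → T (agreeOutside Q x y) → AgreeOutside Q x y
agreeOutside⇒AgreeOutside {Q = Q} {x} {y} h ℓ ℓ∉Q with Q ℓ | x ℓ | y ℓ | all-allFin⁺ h ℓ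
... | true  | _     | _     | _  = ⊥-elim (ℓ∉Q tt)
... | false | true  | true  | _  = refl
... | false | false | false | _  = refl

undetermined⇒switch : ∀ {n} (f : Assign n → Bool) (Q x : Assign n) → T (undetermined f Q x) →
  ∃ λ y → ∃ λ z → AgreeOutside Q x y × AgreeOutside Q x z × T (f y) × ¬ T (f z)
undetermined⇒switch {n} f Q x h with satisfied (any⁻ _ (allAssign n) h)
... | y , h′ with satisfied (any⁻ _ (allAssign n) h′)
... | z , h″ with Equivalence.to (T-∧ {agreeOutside Q x y}) h″
... | x~y , h‴ with Equivalence.to (T-∧ {agreeOutside Q x z}) h‴
... | x~z , differ with switches (f y) (f z) differ
... | inj₁ (fy , ¬fz) = y , z , agreeOutside⇒AgreeOutside x~y , agreeOutside⇒AgreeOutside x~z , fy , ¬fz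
... | inj₂ (¬fy , fz) = z , y , agreeOutside⇒AgreeOutside x~z , agreeOutside⇒AgreeOutside x~y , fz , ¬fy

meets : ∀ {n v} → (Fin n → Fin v) → Assign n → Fin v → Bool
meets blk Q j = not (∣ Q ∩ blockOf blk j ∣ ≡ᵇ 0)

noFullBlock : ∀ {n v} → (Fin n → Fin v) → List (Fin v) → Assign n → Bool
noFullBlock blk L x = all (λ k → not (allOnesOn (blockOf blk k) x)) L

pivotal : ∀ {n v} → (Fin n → Fin v) → Assign n → Fin v → Assign n → Bool
pivotal blk Q j x = allOnesOn (blockOf blk j ∖ Q) x ∧ noFullBlock blk (disjointBlocks blk Q) x

-- Necessary for the bits of Q to switch T_P when the bits outside Q are those of x.
critical : ∀ {n v} → (Fin n → Fin v) → Assign n → Fin v → Assign n → Bool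
critical blk Q j x = meets blk Q j ∧ pivotal blk Q j x

critical-of-switch : ∀ {n v w} (P : Partition n v w) (Q : Assign n) {x y z : Assign n} →
  AgreeOutside Q x y → AgreeOutside Q x z → T (T-P P y) → ¬ T (T-P P z) →
  ∃ λ j → T (critical (proj₁ P) Q j x)
critical-of-switch {n} {v} (blk , _) Q {x} {y} {z} x~y x~z Ty ¬Tz =
  j , Equivalence.from T-∧ (jMeets , Equivalence.from T-∧ (restFull , others))
  where
  fullBlock : ∃ λ j → T (allOnesOn (blockOf blk j) y)
  fullBlock = any-allFin⁻ Ty
  j : Fin v
  j = proj₁ fullBlock
  yFull : T (allOnesOn (blockOf blk j) y)
  yFull = proj₂ fullBlock
  zNotFull : ∀ k → ¬ T (allOnesOn (blockOf blk k) z)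
  zNotFull k h = ¬Tz (any-allFin⁺ {p = λ k → allOnesOn (blockOf blk k) z} k h)
  outsideQ : ∀ k → ∣ Q ∩ blockOf blk k ∣ ≡ 0 → ∀ ℓ → T (blockOf blk k ℓ) → ¬ T (Q ℓ)
  outsideQ k t≡0 ℓ ℓ∈k ℓ∈Q =
    countᵇ≡0⇒¬T (Q ∩ blockOf blk k) (allFin n) t≡0 (∈-allFin ℓ) (Equivalence.from T-∧ (ℓ∈Q , ℓ∈k))
  jMeets : T (meets blk Q j)
  jMeets = ¬T⇒T-not λ t≡ᵇ0 → zNotFull j (subst T (allOnesOn-dependsOnlyOn (blockOf blk j) y z
    (λ ℓ ℓ∈j → let ℓ∉Q = outsideQ j (ℕP.≡ᵇ⇒≡ ∣ Q ∩ blockOf blk j ∣ 0 t≡ᵇ0) ℓ ℓ∈j in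
               trans (x~y ℓ ℓ∉Q) (sym (x~z ℓ ℓ∉Q)))) yFull)
  restFull : T (allOnesOn (blockOf blk j ∖ Q) x)
  restFull = allOnesOn⁻ λ ℓ ℓ∈j∖Q → let (ℓ∈j , ℓ∉Q) = Equivalence.to T-∧ ℓ∈j∖Q in
    subst T (x~y ℓ (T-not⇒¬T ℓ∉Q)) (allOnesOn⁺ {S = blockOf blk j} {y} yFull ℓ ℓ∈j)
  others : T (noFullBlock blk (disjointBlocks blk Q) x)
  others = all⁻ (λ k → not (allOnesOn (blockOf blk k) x)) (All.tabulate xNotFull)
    where
    xNotFull : ∀ {k} → k ∈ disjointBlocks blk Q → T (not (allOnesOn (blockOf blk k) x))
    xNotFull {k} k∈L = ¬T⇒T-not λ xFull → zNotFull k (subst T (allOnesOn-dependsOnlyOn (blockOf blk k) x z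
      (λ ℓ ℓ∈k → sym (x~z ℓ (outsideQ k (∈disjointBlocks⇒≡0 blk Q k∈L) ℓ ℓ∈k)))) xFull)

𝔼-noFullBlock : ∀ {n v w} (P : Partition n v w) {L} → Unique L →
  𝔼 n (𝟙 ∘ noFullBlock (proj₁ P) L) ≡ (1ℚ - 2^- w) ^ℚ length L
𝔼-noFullBlock {n} (blk , blockSize≡w) = 𝔼-all-blocks n blk
  (λ k → dependsOnlyOn-∘ not (allOnesOn-dependsOnlyOn (blockOf blk k)))
  (λ k → trans (𝔼-𝟙-not n (allOnesOn (blockOf blk k)))
               (cong (1ℚ -_) (trans (𝔼-allOnesOn n (blockOf blk k)) (cong 2^-_ (blockSize≡w k)))))

𝔼-pivotal : ∀ {n v w} (P : Partition n v w) (Q : Assign n) (j : Fin v) → T (meets (proj₁ P) Q j) →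
  𝔼 n (𝟙 ∘ pivotal (proj₁ P) Q j)
    ≡ 2^- ∣ blockOf (proj₁ P) j ∖ Q ∣ * (1ℚ - 2^- w) ^ℚ length (disjointBlocks (proj₁ P) Q)
𝔼-pivotal {n} {v} {w} P@(blk , _) Q j jMeets = begin
  𝔼 n (𝟙 ∘ pivotal blk Q j)                           ≡⟨ 𝔼-cong n (λ x → 𝟙-∧ (allOnesOn (blockOf blk j ∖ Q) x) _) ⟩
  𝔼 n (λ x → 𝟙 (allOnesOn (blockOf blk j ∖ Q) x) * 𝟙 (noFullBlock blk L x))
    ≡⟨ 𝔼-*-disjoint n (block-disjoint-union blk j∉L)
         (dependsOnlyOn-∘ 𝟙 (dependsOnlyOn-mono (λ ℓ ℓ∈j∖Q → proj₁ (Equivalence.to T-∧ ℓ∈j∖Q))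
                                                 (allOnesOn-dependsOnlyOn (blockOf blk j ∖ Q))))
         (dependsOnlyOn-∘ 𝟙 (dependsOnlyOn-all blk (λ k → dependsOnlyOn-∘ not (allOnesOn-dependsOnlyOn (blockOf blk k))) L)) ⟩
  𝔼 n (𝟙 ∘ allOnesOn (blockOf blk j ∖ Q)) * 𝔼 n (𝟙 ∘ noFullBlock blk L)
    ≡⟨ cong₂ _*_ (𝔼-allOnesOn n (blockOf blk j ∖ Q)) (𝔼-noFullBlock P (filter⁺ (T? ∘ _) (allFin⁺ _))) ⟩
  2^- ∣ blockOf blk j ∖ Q ∣ * (1ℚ - 2^- w) ^ℚ length L ∎
  where
  open ≡-Reasoning
  L : List (Fin v)
  L = disjointBlocks blk Q
  j∉L : All (j ≢_) L
  j∉L = All.tabulate λ { k∈L refl → T-not⇒¬T jMeets (Equivalence.from T-≡ (cong (_≡ᵇ 0) (∈disjointBlocks⇒≡0 blk Q k∈L))) }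

𝔼-critical≤ : ∀ {n v w q} (P : Partition n v w) (Q : Assign n) (j : Fin v) → .{{NonZero w}} → ∣ Q ∣ ℕ.≤ q →
  𝔼 n (𝟙 ∘ critical (proj₁ P) Q j)
    ≤ (2^- w * (1ℚ - 2^- w) ^ℤ (ℤ.+ v ℤ.- ℤ.+ q)) * ℕ→ℚ (lbTerm (interSize Q P j))
𝔼-critical≤ {n} {v} {w} {q} P@(blk , blockSize≡w) Q j ∣Q∣≤q = begin
  𝔼 n (𝟙 ∘ critical blk Q j)                           ≡⟨ 𝔼-cong n (λ x → 𝟙-∧ (meets blk Q j) (pivotal blk Q j x)) ⟩
  𝔼 n (λ x → 𝟙 (meets blk Q j) * 𝟙 (pivotal blk Q j x)) ≡⟨ 𝔼-*ˡ n (𝟙 (meets blk Q j)) (𝟙 ∘ pivotal blk Q j) ⟩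
  𝟙 (meets blk Q j) * 𝔼 n (𝟙 ∘ pivotal blk Q j)       ≤⟨ byIntersection _ refl ⟩
  K * ℕ→ℚ (lbTerm (interSize Q P j))                    ∎
  where
  open ℚP.≤-Reasoning
  c K : ℚ
  c = (1ℚ - 2^- w) ^ℤ (ℤ.+ v ℤ.- ℤ.+ q)
  K = 2^- w * c
  L : List (Fin v)
  L = disjointBlocks blk Q
  byIntersection : ∀ t → ∣ Q ∩ blockOf blk j ∣ ≡ t → 𝟙 (not (t ≡ᵇ 0)) * 𝔼 n (𝟙 ∘ pivotal blk Q j) ≤ K * ℕ→ℚ (lbTerm t)
  byIntersection zero    _    = ℚP.≤-reflexive (trans (ℚP.*-zeroˡ (𝔼 n (𝟙 ∘ pivotal blk Q j))) (sym (ℚP.*-zeroʳ K)))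
  byIntersection (suc t) t≡1+t = begin
    1ℚ * 𝔼 n (𝟙 ∘ pivotal blk Q j)                 ≡⟨ trans (ℚP.*-identityˡ _) (𝔼-pivotal P Q j jMeets) ⟩
    2^- ∣ blockOf blk j ∖ Q ∣ * (1ℚ - 2^- w) ^ℚ length L ≡⟨ cong (_* (1ℚ - 2^- w) ^ℚ length L) 2^-∣Pj∖Q∣≡2^-w*2^t ⟩
    (2^- w * 2^t) * (1ℚ - 2^- w) ^ℚ length L       ≤⟨ ℚP.*-monoˡ-≤-nonNeg (2^- w * 2^t) {{ℚ.nonNegative 0≤2^-w*2^t}}
                                                        ([1-2^-w]^k≤[1-2^-w]^[v-q] w {v} {q} {length L} v≤∣L∣+q) ⟩
    (2^- w * 2^t) * c                               ≡⟨ solve 3 (λ a b d → (a :* b) :* d := (a :* d) :* b) refl (2^- w) 2^t c ⟩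
    K * 2^t                                         ∎
    where
    open +-*-Solver
    2^t : ℚ
    2^t = ℕ→ℚ (2 ℕ.^ suc t)
    0≤2^-w*2^t : 0ℚ ≤ 2^- w * 2^t
    0≤2^-w*2^t = *-nonNeg (2^-‿nonNeg w) (ℕ→ℚ-nonNeg (2 ℕ.^ suc t))
    jMeets : T (meets blk Q j)
    jMeets = subst (λ t → T (not (t ≡ᵇ 0))) (sym t≡1+t) tt
    2^-∣Pj∖Q∣≡2^-w*2^t : 2^- ∣ blockOf blk j ∖ Q ∣ ≡ 2^- w * 2^t
    2^-∣Pj∖Q∣≡2^-w*2^t = sym (trans (cong (λ m → 2^- m * 2^t) ∣Pj∖Q∣+1+t≡w) (2^-[a+t]*2^t≡2^-a ∣ blockOf blk j ∖ Q ∣ (suc t)))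
      where
      ∣Pj∖Q∣+1+t≡w : w ≡ ∣ blockOf blk j ∖ Q ∣ ℕ.+ suc t
      ∣Pj∖Q∣+1+t≡w = trans (sym (blockSize≡w j))
        (trans (countᵇ-∖-∩ (blockOf blk j) Q (allFin n)) (cong (∣ blockOf blk j ∖ Q ∣ ℕ.+_) t≡1+t))
    v≤∣L∣+q : v ℕ.≤ length L ℕ.+ q
    v≤∣L∣+q = ℕP.≤-trans (v≤∣disjointBlocks∣+∣Q∣ blk Q) (ℕP.+-monoʳ-≤ (length L) ∣Q∣≤q)

module _ {n v w u : ℕ} .{{_ : NonZero w}} .{{_ : NonZero v}} .{{_ : NonZero u}} (𝒫 : Fin u → Partition n v w) where

  undetermined⇒critical : ∀ Q x → T (undetermined (f-𝒫 𝒫) Q x) → ∃ λ i → ∃ λ j → T (critical (proj₁ (𝒫 i)) Q j x)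
  undetermined⇒critical Q x h =
    let (y , z , x~y , x~z , fy , ¬fz) = undetermined⇒switch (f-𝒫 𝒫) Q x h
        (i , ¬Tz)                      = ¬all-allFin ¬fz
    in i , critical-of-switch (𝒫 i) Q x~y x~z (all-allFin⁺ fy i) ¬Tz

  𝟙-undetermined≤∑∑ : ∀ Q x →
    𝟙 (undetermined (f-𝒫 𝒫) Q x) ≤ ∑ (allFin u) (λ i → ∑ (allFin v) (λ j → 𝟙 (critical (proj₁ (𝒫 i)) Q j x)))
  𝟙-undetermined≤∑∑ Q x = begin
    𝟙 (undetermined (f-𝒫 𝒫) Q x)          ≤⟨ 𝟙-mono someCritical ⟩
    𝟙 (any (λ i → any (crit i) (allFin v)) (allFin u))
                                          ≤⟨ 𝟙-any≤∑ (λ i → any (crit i) (allFin v)) (allFin u) ⟩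
    ∑ (allFin u) (λ i → 𝟙 (any (crit i) (allFin v)))
                                          ≤⟨ ∑-mono-≤ (allFin u) (λ i → 𝟙-any≤∑ (crit i) (allFin v)) ⟩
    ∑ (allFin u) (λ i → ∑ (allFin v) (𝟙 ∘ crit i)) ∎
    where
    open ℚP.≤-Reasoning
    crit : Fin u → Fin v → Bool
    crit i j = critical (proj₁ (𝒫 i)) Q j x
    someCritical : T (undetermined (f-𝒫 𝒫) Q x) → T (any (λ i → any (crit i) (allFin v)) (allFin u))
    someCritical h = let (i , j , c) = undetermined⇒critical Q x h in
      any-allFin⁺ {p = λ i → any (crit i) (allFin v)} i (any-allFin⁺ {p = crit i} j c)

  ∑-lbTerm≤ : ∀ {q τ} → LoadBalancing 𝒫 q τ → ∀ {Q} → ∣ Q ∣ ℕ.≤ q → ∀ j →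
    ∑ (allFin u) (λ i → ℕ→ℚ (lbTerm (interSize Q (𝒫 i) j))) ≤ ℕ→ℚ u * (τ * (ℤ.+ q / v))
  ∑-lbTerm≤ {q} {τ} balanced {Q} ∣Q∣≤q j = begin
    ∑ (allFin u) (ℕ→ℚ ∘ load)          ≡⟨ sym (trans (cong ℕ→ℚ (sum-map≡∑ load (allFin u))) (ℕ→ℚ-∑ (allFin u) load)) ⟩
    ℕ→ℚ (sum (map load (allFin u)))     ≡⟨ sym (ℕ→ℚ-*-/ (sum (map load (allFin u))) u) ⟩
    ℕ→ℚ u * (ℤ.+ sum (map load (allFin u)) / u)
                                        ≤⟨ ℚP.*-monoˡ-≤-nonNeg (ℕ→ℚ u) {{ℚ.nonNegative (ℕ→ℚ-nonNeg u)}} (balanced Q ∣Q∣≤q j) ⟩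
    ℕ→ℚ u * (τ * (ℤ.+ q / v))           ∎
    where
    open ℚP.≤-Reasoning
    load : Fin u → ℕ
    load i = lbTerm (interSize Q (𝒫 i) j)

  I-Q≤ : ∀ {q τ} → LoadBalancing 𝒫 q τ → ∀ {Q} → ∣ Q ∣ ℕ.≤ q →
    I-Q (f-𝒫 𝒫) Q ≤ ((ℕ→ℚ u * (1ℚ - 2^- w) ^ℤ (ℤ.+ v ℤ.- ℤ.+ q)) * (τ * 2^- w)) * ℕ→ℚ q
  I-Q≤ {q} {τ} balanced {Q} ∣Q∣≤q = begin
    I-Q (f-𝒫 𝒫) Q
      ≡⟨ I-Q≡𝔼 (f-𝒫 𝒫) Q ⟩
    𝔼 n (𝟙 ∘ undetermined (f-𝒫 𝒫) Q)
      ≤⟨ 𝔼-mono-≤ n (𝟙-undetermined≤∑∑ Q) ⟩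
    𝔼 n (λ x → ∑ (allFin u) (λ i → ∑ (allFin v) (λ j → crit i j x)))
      ≡⟨ trans (𝔼-∑ n (allFin u) (λ i x → ∑ (allFin v) (λ j → crit i j x)))
               (∑-cong (allFin u) (λ i → 𝔼-∑ n (allFin v) (crit i))) ⟩
    ∑ (allFin u) (λ i → ∑ (allFin v) (λ j → 𝔼 n (crit i j)))
      ≤⟨ ∑-mono-≤ (allFin u) (λ i → ∑-mono-≤ (allFin v) (λ j → 𝔼-critical≤ (𝒫 i) Q j ∣Q∣≤q)) ⟩
    ∑ (allFin u) (λ i → ∑ (allFin v) (λ j → K * load i j))
      ≡⟨ trans (∑-cong (allFin u) (λ i → ∑-distribˡ-* (allFin v) K (load i))) (∑-distribˡ-* (allFin u) K _) ⟩
    K * ∑ (allFin u) (λ i → ∑ (allFin v) (load i))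
      ≡⟨ cong (K *_) (∑-comm (allFin u) (allFin v) load) ⟩
    K * ∑ (allFin v) (λ j → ∑ (allFin u) (λ i → load i j))
      ≤⟨ ℚP.*-monoˡ-≤-nonNeg K {{ℚ.nonNegative 0≤K}} (∑-mono-≤ (allFin v) (∑-lbTerm≤ {q} {τ} balanced ∣Q∣≤q)) ⟩
    K * ∑ (allFin v) (λ _ → ℕ→ℚ u * (τ * (ℤ.+ q / v)))
      ≡⟨ cong (K *_) (trans (∑-const (allFin v) (ℕ→ℚ u * (τ * (ℤ.+ q / v))))
                             (cong (λ m → ℕ→ℚ m * (ℕ→ℚ u * (τ * (ℤ.+ q / v)))) (length-tabulate {n = v} id))) ⟩
    K * (ℕ→ℚ v * (ℕ→ℚ u * (τ * (ℤ.+ q / v))))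
      ≡⟨ solve 6 (λ h c V U τ A → (h :* c) :* (V :* (U :* (τ :* A))) := ((U :* c) :* (τ :* h)) :* (V :* A))
           refl (2^- w) c (ℕ→ℚ v) (ℕ→ℚ u) τ (ℤ.+ q / v) ⟩
    ((ℕ→ℚ u * c) * (τ * 2^- w)) * (ℕ→ℚ v * (ℤ.+ q / v))
      ≡⟨ cong (((ℕ→ℚ u * c) * (τ * 2^- w)) *_) (ℕ→ℚ-*-/ q v) ⟩
    ((ℕ→ℚ u * c) * (τ * 2^- w)) * ℕ→ℚ q ∎
    where
    open ℚP.≤-Reasoning
    open +-*-Solver
    c K : ℚ
    c = (1ℚ - 2^- w) ^ℤ (ℤ.+ v ℤ.- ℤ.+ q)
    K = 2^- w * c
    0≤K : 0ℚ ≤ K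
    0≤K = *-nonNeg (2^-‿nonNeg w) ([1-2^-w]^[v-q]-nonNeg w v q)
    crit : Fin u → Fin v → Assign n → ℚ
    crit i j = 𝟙 ∘ critical (proj₁ (𝒫 i)) Q j
    load : Fin u → Fin v → ℚ
    load i j = ℕ→ℚ (lbTerm (interSize Q (𝒫 i) j))

theorem2p5 : (n w v u q : ℕ) → .{{_ : NonZero w}} → .{{_ : NonZero v}} → .{{_ : NonZero u}} →
  n ≡ v ℕ.* w →
  (𝒫 : Fin u → Partition n v w) → (τ : ℚ) →
  LoadBalancing 𝒫 q τ →
  I-q (f-𝒫 𝒫) q ≤ ((ℕ→ℚ u * ((1ℚ - 2^- w) ^ℤ (ℤ.+ v ℤ.- ℤ.+ q))) * (τ * 2^- w)) * ℕ→ℚ q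
theorem2p5 n w v u q _ 𝒫 τ balanced =
  foldr-⊔-≤ _ 0≤bound (AllP.map⁺ (All.map (λ ∣Q∣≤ᵇq → I-Q≤ 𝒫 {q} {τ} balanced (ℕP.≤ᵇ⇒≤ _ q ∣Q∣≤ᵇq))
                                           (AllP.all-filter (T? ∘ λ Q → ∣ Q ∣ ℕ.≤ᵇ q) (allAssign n))))
  where
  ∅ : Assign n
  ∅ _ = false
  ∣∅∣≤q : ∣ ∅ ∣ ℕ.≤ q
  ∣∅∣≤q = subst (ℕ._≤ q) (sym (trans (countᵇ≡∑ ∅ (allFin n)) (ℕ∑.∑-zero (allFin n)))) ℕ.z≤n
  -- The bound dominates I_∅ ≥ 0 (τ alone need not be nonnegative).
  0≤bound : 0ℚ ≤ ((ℕ→ℚ u * ((1ℚ - 2^- w) ^ℤ (ℤ.+ v ℤ.- ℤ.+ q))) * (τ * 2^- w)) * ℕ→ℚ q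
  0≤bound = ℚP.≤-trans (subst (0ℚ ≤_) (sym (I-Q≡𝔼 (f-𝒫 𝒫) ∅)) (𝔼-nonNeg n (𝟙-nonNeg ∘ undetermined (f-𝒫 𝒫) ∅)))
                       (I-Q≤ 𝒫 {q} {τ} balanced ∣∅∣≤q)
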